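{- Let $w\in\mathfrak{W}_p$. If $|(w^{ -1}\Delta)\setminus\Phi_p|=1$, then $\Phi^+\setminus\Phi_p^+$ equals either $(\Phi^+\setminus\Phi_p^+)\cap w^{ -1}\Phi^+$ or $(\Phi^+\setminus\Phi_p^+)\cap w^{ -1}\Phi^-$.
   Context: Let $\Phi$ be a reduced irreducible root system of rank $r$ in a real inner product space, with fundamental system $\Delta=\{\alpha_1,\dots,\alpha_r\}$, positive roots $\Phi^+$, $\Phi^-=-\Phi^+$, coroots $\alpha^\vee=2\alpha/\langle\alpha,\alpha\rangle$, fundamental weights $\lambda_i$ with $\langle\lambda_i,\alpha_j^\vee\rangle=\delta_{ij}$, Weyl group $W$. Fix $1\le p\le r$; $\Delta_p=\Delta\setminus\{\alpha_p\}$, $\Phi_p=\{\alpha\in\Phi:\langle\lambda_p,\alpha^\vee\rangle=0\}$, $\Phi_p^+=\Phi_p\cap\Phi^+$, $\mathfrak{W}_p=\{w\in W:\Delta_p\subset w^{ -1}(\Delta\cup\Phi^-)\}$.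
   Formalization: The root system Φ and the weight $\lambda_p$ lie in ℚ^N with the standard dot product rather than in an arbitrary real inner product space. -}

module Defs where

open import Data.Nat using (ℕ)
open import Data.Integer using (ℤ)
open import Data.Fin using (Fin; _≟_)
open import Data.Rational using (ℚ; 0ℚ; 1ℚ; _+_; _*_; _-_; -_; 1/_; ≢-nonZero; _≤_; _≥_)
  renaming (_/_ to _/ℚ_)
import Data.Rational.Properties as ℚP
open import Data.Vec using (Vec; zipWith; map; replicate; foldr)
open import Data.List using (List)
open import Data.List.Membership.Propositional using (_∈_)
open import Data.Product using (Σ; ∃; _×_; _,_)
open import Data.Sum using (_⊎_)
open import Data.Bool using (Bool; true; false)
open import Relation.Binary.PropositionalEquality using (_≡_; _≢_)
open import Relation.Nullary using (¬_; yes; no)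
open import Function using (_∘_; id)

V : ℕ → Set
V N = Vec ℚ N

module _ {N : ℕ} where

  0v : V N
  0v = replicate _ 0ℚ

  _+v_ : V N → V N → V N
  _+v_ = zipWith _+_

  _·v_ : ℚ → V N → V N
  c ·v v = map (c *_) v

  _-v_ : V N → V N → V N
  u -v v = zipWith _-_ u v

  -v_ : V N → V N
  -v v = map -_ v

  ⟪_,_⟫ : V N → V N → ℚ
  ⟪ u , v ⟫ = foldr (λ _ → ℚ) _+_ 0ℚ (zipWith _*_ u v)

-- total inverse on ℚ (0 ↦ 0); only ever applied to nonzero numbers below
inv : ℚ → ℚ
inv q with q ℚP.≟ 0ℚ
... | yes _ = 0ℚ
... | no q≢0 = 1/_ q {{≢-nonZero q≢0}}

module _ {N : ℕ} where

  ⟪_,_∨⟫ : V N → V N → ℚ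
  ⟪ v , α ∨⟫ = ((1ℚ + 1ℚ) * ⟪ v , α ⟫) * inv ⟪ α , α ⟫

  refl-s : V N → V N → V N
  refl-s α v = v -v (⟪ v , α ∨⟫ ·v α)

  ℤtoℚ : ℤ → ℚ
  ℤtoℚ k = k /ℚ 1

  lincomb : ∀ {r} → (Fin r → ℚ) → (Fin r → V N) → V N
  lincomb {ℕ.zero} c v = 0v
  lincomb {ℕ.suc r} c v = (c Fin.zero ·v v Fin.zero) +v lincomb (c ∘ Fin.suc) (v ∘ Fin.suc)
    where import Data.Fin as Fin

  record IsRootSystem (Φ : List (V N)) : Set where
    field
      zero∉ : ¬ (0v ∈ Φ)
      refl-closed : ∀ {α β} → α ∈ Φ → β ∈ Φ → refl-s α β ∈ Φ
      integral : ∀ {α β} → α ∈ Φ → β ∈ Φ → ∃ λ (k : ℤ) → ⟪ β , α ∨⟫ ≡ ℤtoℚ k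

  IsReduced : List (V N) → Set
  IsReduced Φ = ∀ {α} (c : ℚ) → α ∈ Φ → (c ·v α) ∈ Φ → (c ≡ 1ℚ) ⊎ (c ≡ - 1ℚ)

  -- irreducible: no decomposition Φ = Φ₁ ⊔ Φ₂ into two nonempty mutually orthogonal parts
  IsIrreducible : List (V N) → Set
  IsIrreducible Φ = (f : V N → Bool) →
    (∀ {α β} → α ∈ Φ → β ∈ Φ → f α ≡ true → f β ≡ false → ⟪ α , β ⟫ ≡ 0ℚ) →
    (∀ {α} → α ∈ Φ → f α ≡ true) ⊎ (∀ {α} → α ∈ Φ → f α ≡ false)

  record IsFundamentalSystem {r : ℕ} (Φ : List (V N)) (Δ : Fin r → V N) : Set where
    field
      simple∈ : ∀ i → Δ i ∈ Φ
      linIndep : ∀ (c : Fin r → ℚ) → lincomb c Δ ≡ 0v → ∀ i → c i ≡ 0ℚ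
      integral-signs : ∀ {β} → β ∈ Φ → ∃ λ (k : Fin r → ℤ) →
        (β ≡ lincomb (ℤtoℚ ∘ k) Δ) ×
        ((∀ i → ℤtoℚ (k i) ≥ 0ℚ) ⊎ (∀ i → ℤtoℚ (k i) ≤ 0ℚ))

  Pos : ∀ {r : ℕ} → List (V N) → (Fin r → V N) → V N → Set
  Pos {r} Φ Δ β = β ∈ Φ × ∃ λ (k : Fin r → ℤ) → (β ≡ lincomb (ℤtoℚ ∘ k) Δ) × (∀ i → ℤtoℚ (k i) ≥ 0ℚ)

  Neg : ∀ {r} → List (V N) → (Fin r → V N) → V N → Set
  Neg Φ Δ β = Pos Φ Δ (-v β)

  IsFundWeight : ∀ {r} → (Fin r → V N) → Fin r → V N → Set
  IsFundWeight Δ p λp = ∀ j → ⟪ λp , Δ j ∨⟫ ≡ (case-δ p j)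
    where
      case-δ : ∀ {r} → Fin r → Fin r → ℚ
      case-δ a b with a ≟ b
      ... | yes _ = 1ℚ
      ... | no _ = 0ℚ

  InΦp : List (V N) → V N → V N → Set
  InΦp Φ λp α = α ∈ Φ × ⟪ λp , α ∨⟫ ≡ 0ℚ

  data InWeyl (Φ : List (V N)) : (V N → V N) → Set where
    w-id : InWeyl Φ id
    w-step : ∀ {w α} → α ∈ Φ → InWeyl Φ w → InWeyl Φ (refl-s α ∘ w)

  -- 𝔚_p = {w ∈ W : Δ_p ⊂ w⁻¹(Δ ∪ Φ⁻)}   (w⁻¹X = {β : w β ∈ X})
  InWp : ∀ {r} → List (V N) → (Fin r → V N) → Fin r → (V N → V N) → Set
  InWp Φ Δ p w = InWeyl Φ w ×
    (∀ j → j ≢ p → (∃ λ i → w (Δ j) ≡ Δ i) ⊎ Neg Φ Δ (w (Δ j)))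

  InInvImgΔ : ∀ {r} → (Fin r → V N) → (V N → V N) → V N → Set
  InInvImgΔ Δ w β = ∃ λ i → w β ≡ Δ i

{-# OPTIONS --safe #-}
module Submission where

-- For w ∈ W and λ = λ_p, pairing with λ pulls back along w: if w β = Σ k_i α_i then
-- ⟨λ, β⟩ = Σ k_i ⟨λ, w⁻¹ α_i⟩.  Each w⁻¹ α_i either lies in Φ_p, where ⟨λ, ·⟩ vanishes,
-- or is the unique root γ of w⁻¹Δ outside Φ_p; so ⟨λ, w⁻¹ α_i⟩ ∈ {0, c} with c = ⟨λ, γ⟩.
-- A positive root β ∉ Φ_p has ⟨λ, β⟩ > 0, whereas the coefficients k_i share one sign;
-- so that sign is forced to be the sign of c, independently of β.

open import Defs
open import Level using (0ℓ)
open import Data.Nat using (ℕ; zero; suc)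
open import Data.Integer as ℤ using (ℤ; -[1+_])
open import Data.Fin using (Fin; zero; suc; _≟_)
open import Data.Vec using (Vec; []; _∷_)
open import Data.List using (List)
open import Data.List.Membership.Propositional using (_∈_)
open import Data.Product using (∃; _×_; _,_; proj₁; proj₂)
open import Data.Sum using (_⊎_; inj₁; inj₂)
open import Data.Empty using (⊥-elim)
open import Data.Rational
  using (ℚ; 0ℚ; 1ℚ; _+_; _*_; _-_; -_; 1/_; _≤_; ≢-nonZero; nonNegative; nonPositive)
import Data.Rational.Properties as ℚ
open import Relation.Binary.PropositionalEquality
open import Relation.Nullary using (¬_; yes; no)
open import Relation.Nullary.Decidable.Core using (dec⇒maybe)
open import Function using (_∘_; id)
open import Tactic.RingSolver using (solve-∀)
open import Tactic.RingSolver.Core.AlmostCommutativeRing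
  using (AlmostCommutativeRing; fromCommutativeRing)

ℚ-ring : AlmostCommutativeRing 0ℓ 0ℓ
ℚ-ring = fromCommutativeRing ℚ.+-*-commutativeRing (λ x → dec⇒maybe (0ℚ ℚ.≟ x))

½ : ℚ
½ = 1/ (1ℚ + 1ℚ)

inv-inverseʳ : ∀ q → q ≢ 0ℚ → q * inv q ≡ 1ℚ
inv-inverseʳ q q≢0 with q ℚ.≟ 0ℚ
... | yes q≡0 = ⊥-elim (q≢0 q≡0)
... | no q≢0′ = ℚ.*-inverseʳ q {{≢-nonZero q≢0′}}

*-nonNeg-nonNeg : ∀ {a b} → 0ℚ ≤ a → 0ℚ ≤ b → 0ℚ ≤ a * b
*-nonNeg-nonNeg {a} {b} a≥0 b≥0 = ℚ.nonNegative⁻¹ _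
  {{ℚ.nonNeg*nonNeg⇒nonNeg a {{nonNegative a≥0}} b {{nonNegative b≥0}}}}

*-nonPos-nonNeg : ∀ {a b} → a ≤ 0ℚ → 0ℚ ≤ b → a * b ≤ 0ℚ
*-nonPos-nonNeg {a} {b} a≤0 b≥0 = ℚ.nonPositive⁻¹ _
  {{ℚ.nonPos*nonNeg⇒nonPos a {{nonPositive a≤0}} b {{nonNegative b≥0}}}}

*-nonNeg-nonPos : ∀ {a b} → 0ℚ ≤ a → b ≤ 0ℚ → a * b ≤ 0ℚ
*-nonNeg-nonPos {a} {b} a≥0 b≤0 = ℚ.nonPositive⁻¹ _
  {{ℚ.nonNeg*nonPos⇒nonPos a {{nonNegative a≥0}} b {{nonPositive b≤0}}}}

square-nonNeg : ∀ a → 0ℚ ≤ a * a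
square-nonNeg a with ℚ.≤-total 0ℚ a
... | inj₁ a≥0 = *-nonNeg-nonNeg a≥0 a≥0
... | inj₂ a≤0 = ℚ.nonNegative⁻¹ _ {{ℚ.nonPos*nonPos⇒nonPos a {{nonPositive a≤0}} a {{nonPositive a≤0}}}}

square≡0⇒≡0 : ∀ a → a * a ≡ 0ℚ → a ≡ 0ℚ
square≡0⇒≡0 a a²≡0 with a ℚ.≟ 0ℚ
... | yes a≡0 = a≡0
... | no a≢0 = ⊥-elim (a≢0 (begin
  a                  ≡⟨ sym (ℚ.*-identityʳ a) ⟩
  a * 1ℚ             ≡⟨ cong (a *_) (sym (ℚ.*-inverseʳ a)) ⟩
  a * (a * a⁻¹)      ≡⟨ sym (ℚ.*-assoc a a a⁻¹) ⟩
  (a * a) * a⁻¹      ≡⟨ cong (_* a⁻¹) a²≡0 ⟩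
  0ℚ * a⁻¹           ≡⟨ ℚ.*-zeroˡ a⁻¹ ⟩
  0ℚ                 ∎))
  where
  open ≡-Reasoning
  instance _ = ≢-nonZero a≢0
  a⁻¹ = 1/ a

nonNeg+nonNeg≡0 : ∀ {a b} → 0ℚ ≤ a → 0ℚ ≤ b → a + b ≡ 0ℚ → a ≡ 0ℚ × b ≡ 0ℚ
nonNeg+nonNeg≡0 {a} {b} a≥0 b≥0 a+b≡0 = ℚ.≤-antisym a≤0 a≥0 , ℚ.≤-antisym b≤0 b≥0
  where
  a≤0 : a ≤ 0ℚ
  a≤0 = subst (a ≤_) a+b≡0 (subst (_≤ a + b) (ℚ.+-identityʳ a) (ℚ.+-monoʳ-≤ a b≥0))
  b≤0 : b ≤ 0ℚ
  b≤0 = subst (b ≤_) a+b≡0 (subst (_≤ a + b) (ℚ.+-identityˡ b) (ℚ.+-monoˡ-≤ b a≥0))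

ℤtoℚ-neg : ∀ {N} k → ℤtoℚ {N} (ℤ.- k) ≡ - ℤtoℚ {N} k
ℤtoℚ-neg (ℤ.+ zero)  = refl
ℤtoℚ-neg (ℤ.+ suc n) = refl
ℤtoℚ-neg -[1+ n ]    = sym (⁻¹-involutive _)
  where open import Algebra.Properties.Group ℚ.+-0-group using (⁻¹-involutive)

∑ : ∀ {r} → (Fin r → ℚ) → ℚ
∑ {zero}  f = 0ℚ
∑ {suc r} f = f zero + ∑ (f ∘ suc)

∑-nonNeg : ∀ {r} (f : Fin r → ℚ) → (∀ i → 0ℚ ≤ f i) → 0ℚ ≤ ∑ f
∑-nonNeg {zero}  f f≥0 = ℚ.≤-refl
∑-nonNeg {suc r} f f≥0 = ℚ.+-mono-≤ (f≥0 zero) (∑-nonNeg (f ∘ suc) (f≥0 ∘ suc))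

∑-nonPos : ∀ {r} (f : Fin r → ℚ) → (∀ i → f i ≤ 0ℚ) → ∑ f ≤ 0ℚ
∑-nonPos {zero}  f f≤0 = ℚ.≤-refl
∑-nonPos {suc r} f f≤0 = ℚ.+-mono-≤ (f≤0 zero) (∑-nonPos (f ∘ suc) (f≤0 ∘ suc))

∑-*-twoValued-nonPos : ∀ {r} {c : ℚ} (k t : Fin r → ℚ) →
  (∀ i → t i ≡ 0ℚ ⊎ t i ≡ c) → (∀ i → k i * c ≤ 0ℚ) → ∑ (λ i → k i * t i) ≤ 0ℚ
∑-*-twoValued-nonPos {c = c} k t t≡0⊎c kc≤0 = ∑-nonPos _ term≤0
  where
  term≤0 : ∀ i → k i * t i ≤ 0ℚ
  term≤0 i with t≡0⊎c i
  ... | inj₁ tᵢ≡0 = ℚ.≤-reflexive (trans (cong (k i *_) tᵢ≡0) (ℚ.*-zeroʳ (k i)))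
  ... | inj₂ tᵢ≡c = subst (λ x → k i * x ≤ 0ℚ) (sym tᵢ≡c) (kc≤0 i)

⟪⟫-+ˡ : ∀ {n} (u v x : Vec ℚ n) → ⟪ u +v v , x ⟫ ≡ ⟪ u , x ⟫ + ⟪ v , x ⟫
⟪⟫-+ˡ []      []      []      = refl
⟪⟫-+ˡ (a ∷ u) (b ∷ v) (c ∷ x) = trans (cong (((a + b) * c) +_) (⟪⟫-+ˡ u v x)) (ring a b c _ _)
  where
  ring : ∀ a b c s t → (a + b) * c + (s + t) ≡ (a * c + s) + (b * c + t)
  ring = solve-∀ ℚ-ring

⟪⟫-*ˡ : ∀ {n} k (u x : Vec ℚ n) → ⟪ k ·v u , x ⟫ ≡ k * ⟪ u , x ⟫
⟪⟫-*ˡ k []      []      = sym (ℚ.*-zeroʳ k)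
⟪⟫-*ˡ k (a ∷ u) (c ∷ x) = trans (cong (((k * a) * c) +_) (⟪⟫-*ˡ k u x)) (ring k a c _)
  where
  ring : ∀ k a c s → (k * a) * c + k * s ≡ k * (a * c + s)
  ring = solve-∀ ℚ-ring

⟪⟫--ˡ : ∀ {n} (u v x : Vec ℚ n) → ⟪ u -v v , x ⟫ ≡ ⟪ u , x ⟫ - ⟪ v , x ⟫
⟪⟫--ˡ []      []      []      = refl
⟪⟫--ˡ (a ∷ u) (b ∷ v) (c ∷ x) = trans (cong (((a - b) * c) +_) (⟪⟫--ˡ u v x)) (ring a b c _ _)
  where
  ring : ∀ a b c s t → (a - b) * c + (s - t) ≡ (a * c + s) - (b * c + t)
  ring = solve-∀ ℚ-ring

⟪⟫-0ˡ : ∀ {n} (x : Vec ℚ n) → ⟪ 0v , x ⟫ ≡ 0ℚ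
⟪⟫-0ˡ []      = refl
⟪⟫-0ˡ (c ∷ x) = trans (cong₂ _+_ (ℚ.*-zeroˡ c) (⟪⟫-0ˡ x)) (ℚ.+-identityˡ 0ℚ)

⟪⟫-comm : ∀ {n} (u x : Vec ℚ n) → ⟪ u , x ⟫ ≡ ⟪ x , u ⟫
⟪⟫-comm []      []      = refl
⟪⟫-comm (a ∷ u) (c ∷ x) = cong₂ _+_ (ℚ.*-comm a c) (⟪⟫-comm u x)

⟪⟫-self-nonNeg : ∀ {n} (v : Vec ℚ n) → 0ℚ ≤ ⟪ v , v ⟫
⟪⟫-self-nonNeg []      = ℚ.≤-refl
⟪⟫-self-nonNeg (a ∷ v) = ℚ.+-mono-≤ (square-nonNeg a) (⟪⟫-self-nonNeg v)

⟪⟫-self≡0⇒≡0v : ∀ {n} (v : Vec ℚ n) → ⟪ v , v ⟫ ≡ 0ℚ → v ≡ 0v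
⟪⟫-self≡0⇒≡0v []      _   = refl
⟪⟫-self≡0⇒≡0v (a ∷ v) eq0 with nonNeg+nonNeg≡0 (square-nonNeg a) (⟪⟫-self-nonNeg v) eq0
... | a²≡0 , ∣v∣²≡0 = cong₂ _∷_ (square≡0⇒≡0 a a²≡0) (⟪⟫-self≡0⇒≡0v v ∣v∣²≡0)

⟪⟫-lincomb : ∀ {n r} (x : Vec ℚ n) (c : Fin r → ℚ) (vs : Fin r → Vec ℚ n) →
  ⟪ x , lincomb c vs ⟫ ≡ ∑ (λ i → c i * ⟪ x , vs i ⟫)
⟪⟫-lincomb {r = zero}  x c vs = trans (⟪⟫-comm x 0v) (⟪⟫-0ˡ x)
⟪⟫-lincomb {r = suc r} x c vs = begin
  ⟪ x , (c zero ·v vs zero) +v rest ⟫           ≡⟨ ⟪⟫-comm x _ ⟩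
  ⟪ (c zero ·v vs zero) +v rest , x ⟫           ≡⟨ ⟪⟫-+ˡ (c zero ·v vs zero) rest x ⟩
  ⟪ c zero ·v vs zero , x ⟫ + ⟪ rest , x ⟫      ≡⟨ cong₂ _+_ (⟪⟫-*ˡ (c zero) (vs zero) x) (⟪⟫-comm rest x) ⟩
  c zero * ⟪ vs zero , x ⟫ + ⟪ x , rest ⟫       ≡⟨ cong₂ _+_ (cong (c zero *_) (⟪⟫-comm (vs zero) x))
                                                             (⟪⟫-lincomb x (c ∘ suc) (vs ∘ suc)) ⟩
  c zero * ⟪ x , vs zero ⟫ + ∑ (λ i → c (suc i) * ⟪ x , vs (suc i) ⟫) ∎
  where
  open ≡-Reasoning
  rest = lincomb (c ∘ suc) (vs ∘ suc)

module _ {n : ℕ} where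

  private
    coroot-scaling : Vec ℚ n → ℚ → ℚ
    coroot-scaling x q = ((1ℚ + 1ℚ) * q) * inv ⟪ x , x ⟫

  ∨-+ˡ : (u v x : Vec ℚ n) → ⟪ u +v v , x ∨⟫ ≡ ⟪ u , x ∨⟫ + ⟪ v , x ∨⟫
  ∨-+ˡ u v x = trans (cong (coroot-scaling x) (⟪⟫-+ˡ u v x)) (ring ⟪ u , x ⟫ ⟪ v , x ⟫ (inv ⟪ x , x ⟫))
    where
    ring : ∀ s t i → ((1ℚ + 1ℚ) * (s + t)) * i ≡ ((1ℚ + 1ℚ) * s) * i + ((1ℚ + 1ℚ) * t) * i
    ring = solve-∀ ℚ-ring

  ∨-*ˡ : ∀ k (u x : Vec ℚ n) → ⟪ k ·v u , x ∨⟫ ≡ k * ⟪ u , x ∨⟫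
  ∨-*ˡ k u x = trans (cong (coroot-scaling x) (⟪⟫-*ˡ k u x)) (ring k ⟪ u , x ⟫ (inv ⟪ x , x ⟫))
    where
    ring : ∀ k s i → ((1ℚ + 1ℚ) * (k * s)) * i ≡ k * (((1ℚ + 1ℚ) * s) * i)
    ring = solve-∀ ℚ-ring

  ∨--ˡ : (u v x : Vec ℚ n) → ⟪ u -v v , x ∨⟫ ≡ ⟪ u , x ∨⟫ - ⟪ v , x ∨⟫
  ∨--ˡ u v x = trans (cong (coroot-scaling x) (⟪⟫--ˡ u v x)) (ring ⟪ u , x ⟫ ⟪ v , x ⟫ (inv ⟪ x , x ⟫))
    where
    ring : ∀ s t i → ((1ℚ + 1ℚ) * (s - t)) * i ≡ ((1ℚ + 1ℚ) * s) * i - ((1ℚ + 1ℚ) * t) * i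
    ring = solve-∀ ℚ-ring

  ⟪⟫≡0⇒∨≡0 : (v x : Vec ℚ n) → ⟪ v , x ⟫ ≡ 0ℚ → ⟪ v , x ∨⟫ ≡ 0ℚ
  ⟪⟫≡0⇒∨≡0 v x eq = trans (cong (coroot-scaling x) eq)
    (trans (cong (_* inv ⟪ x , x ⟫) (ℚ.*-zeroʳ (1ℚ + 1ℚ))) (ℚ.*-zeroˡ (inv ⟪ x , x ⟫)))

  ∨-self : (x : Vec ℚ n) → ⟪ x , x ⟫ ≢ 0ℚ → ⟪ x , x ∨⟫ ≡ 1ℚ + 1ℚ
  ∨-self x ∣x∣≢0 = begin
    ((1ℚ + 1ℚ) * ⟪ x , x ⟫) * inv ⟪ x , x ⟫  ≡⟨ ℚ.*-assoc (1ℚ + 1ℚ) ⟪ x , x ⟫ _ ⟩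
    (1ℚ + 1ℚ) * (⟪ x , x ⟫ * inv ⟪ x , x ⟫)  ≡⟨ cong ((1ℚ + 1ℚ) *_) (inv-inverseʳ _ ∣x∣≢0) ⟩
    (1ℚ + 1ℚ) * 1ℚ                          ≡⟨ ℚ.*-identityʳ (1ℚ + 1ℚ) ⟩
    1ℚ + 1ℚ                                 ∎
    where open ≡-Reasoning

  ⟪⟫-via-∨ : (v x : Vec ℚ n) → ⟪ x , x ⟫ ≢ 0ℚ → ⟪ v , x ⟫ ≡ (⟪ v , x ∨⟫ * ⟪ x , x ⟫) * ½
  ⟪⟫-via-∨ v x ∣x∣≢0 = begin
    ⟪ v , x ⟫                                          ≡⟨ sym (ℚ.*-identityʳ _) ⟩
    ⟪ v , x ⟫ * 1ℚ                                     ≡⟨ cong (⟪ v , x ⟫ *_) (sym (inv-inverseʳ _ ∣x∣≢0)) ⟩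
    ⟪ v , x ⟫ * (⟪ x , x ⟫ * inv ⟪ x , x ⟫)            ≡⟨ sym (ℚ.*-identityʳ _) ⟩
    ⟪ v , x ⟫ * (⟪ x , x ⟫ * inv ⟪ x , x ⟫) * ((1ℚ + 1ℚ) * ½) ≡⟨ ring ⟪ v , x ⟫ ⟪ x , x ⟫ (inv ⟪ x , x ⟫) ½ ⟩
    (⟪ v , x ∨⟫ * ⟪ x , x ⟫) * ½                       ∎
    where
    open ≡-Reasoning
    ring : ∀ s q i h → s * (q * i) * ((1ℚ + 1ℚ) * h) ≡ ((((1ℚ + 1ℚ) * s) * i) * q) * h
    ring = solve-∀ ℚ-ring

  private
    sub-distrib-+ : ∀ {m} (u v x : Vec ℚ m) a b →
      (u +v v) -v ((a + b) ·v x) ≡ (u -v (a ·v x)) +v (v -v (b ·v x))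
    sub-distrib-+ []      []      []      a b = refl
    sub-distrib-+ (p ∷ u) (q ∷ v) (r ∷ x) a b = cong₂ _∷_ (ring p q r a b) (sub-distrib-+ u v x a b)
      where
      ring : ∀ p q r a b → (p + q) - (a + b) * r ≡ (p - a * r) + (q - b * r)
      ring = solve-∀ ℚ-ring

    sub-distrib-· : ∀ {m} k (u x : Vec ℚ m) a → (k ·v u) -v ((k * a) ·v x) ≡ k ·v (u -v (a ·v x))
    sub-distrib-· k []      []      a = refl
    sub-distrib-· k (p ∷ u) (r ∷ x) a = cong₂ _∷_ (ring k p r a) (sub-distrib-· k u x a)
      where
      ring : ∀ k p r a → k * p - (k * a) * r ≡ k * (p - a * r)
      ring = solve-∀ ℚ-ring

    0v-sub-0· : ∀ {m} (x : Vec ℚ m) → 0v -v (0ℚ ·v x) ≡ 0v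
    0v-sub-0· []      = refl
    0v-sub-0· (r ∷ x) = cong₂ _∷_ (ring r) (0v-sub-0· x)
      where
      ring : ∀ r → 0ℚ - 0ℚ * r ≡ 0ℚ
      ring = solve-∀ ℚ-ring

    sub-sub-cancel : ∀ {m} (v x : Vec ℚ m) a → (v -v (a ·v x)) -v ((a - a * (1ℚ + 1ℚ)) ·v x) ≡ v
    sub-sub-cancel []      []      a = refl
    sub-sub-cancel (p ∷ v) (r ∷ x) a = cong₂ _∷_ (ring p r a) (sub-sub-cancel v x a)
      where
      ring : ∀ p r a → (p - a * r) - (a - a * (1ℚ + 1ℚ)) * r ≡ p
      ring = solve-∀ ℚ-ring

    sub-twice-self : ∀ {m} (x : Vec ℚ m) → x -v ((1ℚ + 1ℚ) ·v x) ≡ -v x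
    sub-twice-self []      = refl
    sub-twice-self (r ∷ x) = cong₂ _∷_ (ring r) (sub-twice-self x)
      where
      ring : ∀ r → r - (1ℚ + 1ℚ) * r ≡ - r
      ring = solve-∀ ℚ-ring

  refl-s-+ : (x u v : Vec ℚ n) → refl-s x (u +v v) ≡ refl-s x u +v refl-s x v
  refl-s-+ x u v = trans (cong (λ c → (u +v v) -v (c ·v x)) (∨-+ˡ u v x)) (sub-distrib-+ u v x ⟪ u , x ∨⟫ ⟪ v , x ∨⟫)

  refl-s-* : (x : Vec ℚ n) (k : ℚ) (u : Vec ℚ n) → refl-s x (k ·v u) ≡ k ·v refl-s x u
  refl-s-* x k u = trans (cong (λ c → (k ·v u) -v (c ·v x)) (∨-*ˡ k u x)) (sub-distrib-· k u x ⟪ u , x ∨⟫)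

  refl-s-0 : (x : Vec ℚ n) → refl-s x 0v ≡ 0v
  refl-s-0 x = trans (cong (λ c → 0v -v (c ·v x)) (⟪⟫≡0⇒∨≡0 0v x (⟪⟫-0ˡ x))) (0v-sub-0· x)

  refl-s-involutive : (x : Vec ℚ n) → ⟪ x , x ⟫ ≢ 0ℚ → ∀ v → refl-s x (refl-s x v) ≡ v
  refl-s-involutive x ∣x∣≢0 v = trans (cong (λ c → (v -v (a ·v x)) -v (c ·v x)) pairing) (sub-sub-cancel v x a)
    where
    a = ⟪ v , x ∨⟫
    pairing : ⟪ v -v (a ·v x) , x ∨⟫ ≡ a - a * (1ℚ + 1ℚ)
    pairing = trans (∨--ˡ v (a ·v x) x) (cong (λ b → a - b) (trans (∨-*ˡ a x x) (cong (a *_) (∨-self x ∣x∣≢0))))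

  refl-s-self : (x : Vec ℚ n) → ⟪ x , x ⟫ ≢ 0ℚ → refl-s x x ≡ -v x
  refl-s-self x ∣x∣≢0 = trans (cong (λ c → x -v (c ·v x)) (∨-self x ∣x∣≢0)) (sub-twice-self x)

record IsLinear {n : ℕ} (f : Vec ℚ n → Vec ℚ n) : Set where
  field
    +-homo : ∀ u v → f (u +v v) ≡ f u +v f v
    ·-homo : ∀ k u → f (k ·v u) ≡ k ·v f u
    0-homo : f 0v ≡ 0v

module _ {n : ℕ} where

  id-isLinear : IsLinear {n} id
  id-isLinear = record { +-homo = λ _ _ → refl ; ·-homo = λ _ _ → refl ; 0-homo = refl }

  ∘-isLinear : ∀ {f g : Vec ℚ n → Vec ℚ n} → IsLinear f → IsLinear g → IsLinear (f ∘ g)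
  ∘-isLinear {f} {g} F G = record
    { +-homo = λ u v → trans (cong f (G.+-homo u v)) (F.+-homo (g u) (g v))
    ; ·-homo = λ k u → trans (cong f (G.·-homo k u)) (F.·-homo k (g u))
    ; 0-homo = trans (cong f G.0-homo) F.0-homo
    }
    where
    module F = IsLinear F
    module G = IsLinear G

  refl-s-isLinear : (x : Vec ℚ n) → IsLinear (refl-s x)
  refl-s-isLinear x = record { +-homo = refl-s-+ x ; ·-homo = refl-s-* x ; 0-homo = refl-s-0 x }

  linear-lincomb : ∀ {f r} → IsLinear f → (c : Fin r → ℚ) (vs : Fin r → Vec ℚ n) →
    f (lincomb c vs) ≡ lincomb c (f ∘ vs)
  linear-lincomb {r = zero}  F c vs = IsLinear.0-homo F
  linear-lincomb {r = suc r} F c vs = trans (IsLinear.+-homo F _ _)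
    (cong₂ _+v_ (IsLinear.·-homo F (c zero) (vs zero)) (linear-lincomb F (c ∘ suc) (vs ∘ suc)))

  lincomb-cong : ∀ {r} {c d : Fin r → ℚ} (vs : Fin r → Vec ℚ n) → (∀ i → c i ≡ d i) →
    lincomb c vs ≡ lincomb d vs
  lincomb-cong {zero}  vs c≗d = refl
  lincomb-cong {suc r} vs c≗d =
    cong₂ _+v_ (cong (_·v vs zero) (c≗d zero)) (lincomb-cong (vs ∘ suc) (c≗d ∘ suc))

  private
    neg-distrib-·+ : ∀ {m} a (x y : Vec ℚ m) → -v ((a ·v x) +v y) ≡ ((- a) ·v x) +v (-v y)
    neg-distrib-·+ a []      []      = refl
    neg-distrib-·+ a (p ∷ x) (q ∷ y) = cong₂ _∷_ (ring a p q) (neg-distrib-·+ a x y)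
      where
      ring : ∀ a p q → - (a * p + q) ≡ (- a) * p + - q
      ring = solve-∀ ℚ-ring

    neg-0v : ∀ {m} → -v 0v {m} ≡ 0v
    neg-0v {zero}  = refl
    neg-0v {suc m} = cong₂ _∷_ refl (neg-0v {m})

  neg-lincomb : ∀ {r} (c : Fin r → ℚ) (vs : Fin r → Vec ℚ n) → -v lincomb c vs ≡ lincomb (-_ ∘ c) vs
  neg-lincomb {zero}  c vs = neg-0v
  neg-lincomb {suc r} c vs = trans (neg-distrib-·+ (c zero) (vs zero) _)
    (cong (((- c zero) ·v vs zero) +v_) (neg-lincomb (c ∘ suc) (vs ∘ suc)))

module WeylGroup {n : ℕ} {Φ : List (V n)} (RS : IsRootSystem Φ) where
  open IsRootSystem RS

  root-norm≢0 : ∀ {α} → α ∈ Φ → ⟪ α , α ⟫ ≢ 0ℚ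
  root-norm≢0 {α} α∈Φ ∣α∣≡0 = zero∉ (subst (_∈ Φ) (⟪⟫-self≡0⇒≡0v α ∣α∣≡0) α∈Φ)

  neg-root : ∀ {α} → α ∈ Φ → -v α ∈ Φ
  neg-root {α} α∈Φ = subst (_∈ Φ) (refl-s-self α (root-norm≢0 α∈Φ)) (refl-closed α∈Φ α∈Φ)

  inverse : ∀ {w} → InWeyl Φ w → V n → V n
  inverse w-id                  = id
  inverse (w-step {α = α} _ w∈W) = inverse w∈W ∘ refl-s α

  inverse-isLinear : ∀ {w} (w∈W : InWeyl Φ w) → IsLinear (inverse w∈W)
  inverse-isLinear w-id                   = id-isLinear
  inverse-isLinear (w-step {α = α} _ w∈W) = ∘-isLinear (inverse-isLinear w∈W) (refl-s-isLinear α)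

  inverse-inverseʳ : ∀ {w} (w∈W : InWeyl Φ w) v → w (inverse w∈W v) ≡ v
  inverse-inverseʳ w-id                     v = refl
  inverse-inverseʳ (w-step {α = α} α∈Φ w∈W) v =
    trans (cong (refl-s α) (inverse-inverseʳ w∈W (refl-s α v))) (refl-s-involutive α (root-norm≢0 α∈Φ) v)

  inverse-inverseˡ : ∀ {w} (w∈W : InWeyl Φ w) v → inverse w∈W (w v) ≡ v
  inverse-inverseˡ w-id                         v = refl
  inverse-inverseˡ (w-step {w} {α} α∈Φ w∈W) v =
    trans (cong (inverse w∈W) (refl-s-involutive α (root-norm≢0 α∈Φ) (w v))) (inverse-inverseˡ w∈W v)

  W-preserves-Φ : ∀ {w β} → InWeyl Φ w → β ∈ Φ → w β ∈ Φ
  W-preserves-Φ w-id                 β∈Φ = β∈Φ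
  W-preserves-Φ (w-step α∈Φ w∈W) β∈Φ = refl-closed α∈Φ (W-preserves-Φ w∈W β∈Φ)

  inverse-preserves-Φ : ∀ {w β} (w∈W : InWeyl Φ w) → β ∈ Φ → inverse w∈W β ∈ Φ
  inverse-preserves-Φ w-id                 β∈Φ = β∈Φ
  inverse-preserves-Φ (w-step α∈Φ w∈W) β∈Φ = inverse-preserves-Φ w∈W (refl-closed α∈Φ β∈Φ)

  ⟪⟫-pullback : ∀ {w : V n → V n} {r} (w∈W : InWeyl Φ w) (u β : V n) (k : Fin r → ℚ) (vs : Fin r → V n) →
    w β ≡ lincomb k vs → ⟪ u , β ⟫ ≡ ∑ (λ i → k i * ⟪ u , inverse w∈W (vs i) ⟫)
  ⟪⟫-pullback {w} w∈W u β k vs wβ≡ = begin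
    ⟪ u , β ⟫                                 ≡⟨ cong ⟪ u ,_⟫ (sym (inverse-inverseˡ w∈W β)) ⟩
    ⟪ u , inverse w∈W (w β) ⟫                 ≡⟨ cong (λ v → ⟪ u , inverse w∈W v ⟫) wβ≡ ⟩
    ⟪ u , inverse w∈W (lincomb k vs) ⟫        ≡⟨ cong ⟪ u ,_⟫ (linear-lincomb (inverse-isLinear w∈W) k vs) ⟩
    ⟪ u , lincomb k (inverse w∈W ∘ vs) ⟫      ≡⟨ ⟪⟫-lincomb u k (inverse w∈W ∘ vs) ⟩
    ∑ (λ i → k i * ⟪ u , inverse w∈W (vs i) ⟫) ∎
    where open ≡-Reasoning

module _ {N r : ℕ} {Φ : List (V N)} {Δ : Fin r → V N}
         (RS : IsRootSystem Φ) (FS : IsFundamentalSystem Φ Δ) where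
  open IsRootSystem RS
  open IsFundamentalSystem FS
  open WeylGroup RS

  nonPos-coefficients⇒Neg : ∀ {β} (k : Fin r → ℤ) → β ∈ Φ → β ≡ lincomb (ℤtoℚ {N} ∘ k) Δ →
    (∀ i → ℤtoℚ {N} (k i) ≤ 0ℚ) → Neg Φ Δ β
  nonPos-coefficients⇒Neg {β} k β∈Φ β≡ k≤0 = neg-root β∈Φ , ℤ.-_ ∘ k , -β≡ , -k≥0
    where
    -β≡ : -v β ≡ lincomb (ℤtoℚ {N} ∘ ℤ.-_ ∘ k) Δ
    -β≡ = trans (cong -v_ β≡) (trans (neg-lincomb (ℤtoℚ {N} ∘ k) Δ)
            (lincomb-cong Δ (λ i → sym (ℤtoℚ-neg {N} (k i)))))
    -k≥0 : ∀ i → 0ℚ ≤ ℤtoℚ {N} (ℤ.- k i)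
    -k≥0 i = subst (0ℚ ≤_) (sym (ℤtoℚ-neg {N} (k i))) (ℚ.neg-antimono-≤ (k≤0 i))

  module _ (p : Fin r) (λp : V N) (FW : IsFundWeight Δ p λp) where

    ⟪λ,simple⟫-nonNeg : ∀ j → 0ℚ ≤ ⟪ λp , Δ j ⟫
    ⟪λ,simple⟫-nonNeg j = subst (0ℚ ≤_) (sym (⟪⟫-via-∨ λp (Δ j) (root-norm≢0 (simple∈ j))))
      (*-nonNeg-nonNeg (*-nonNeg-nonNeg coroot-nonNeg (⟪⟫-self-nonNeg (Δ j))) (ℚ.nonNegative⁻¹ ½))
      where
      coroot-nonNeg : 0ℚ ≤ ⟪ λp , Δ j ∨⟫
      coroot-nonNeg rewrite FW j with p ≟ j
      ... | yes _ = ℚ.nonNegative⁻¹ 1ℚ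
      ... | no  _ = ℚ.≤-refl

    Pos⇒⟪λ,⟫-nonNeg : ∀ {β} → Pos Φ Δ β → 0ℚ ≤ ⟪ λp , β ⟫
    Pos⇒⟪λ,⟫-nonNeg (_ , k , β≡ , k≥0) =
      subst (0ℚ ≤_) (sym (trans (cong ⟪ λp ,_⟫ β≡) (⟪⟫-lincomb λp (ℤtoℚ {N} ∘ k) Δ)))
        (∑-nonNeg _ (λ j → *-nonNeg-nonNeg (k≥0 j) (⟪λ,simple⟫-nonNeg j)))

    Pos∧⟪λ,⟫≤0⇒InΦp : ∀ {β} → Pos Φ Δ β → ⟪ λp , β ⟫ ≤ 0ℚ → InΦp Φ λp β
    Pos∧⟪λ,⟫≤0⇒InΦp {β} β⁺ ⟪λ,β⟫≤0 =
      proj₁ β⁺ , ⟪⟫≡0⇒∨≡0 λp β (ℚ.≤-antisym ⟪λ,β⟫≤0 (Pos⇒⟪λ,⟫-nonNeg β⁺))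

    InΦp⇒⟪λ,⟫≡0 : ∀ {β} → InΦp Φ λp β → ⟪ λp , β ⟫ ≡ 0ℚ
    InΦp⇒⟪λ,⟫≡0 {β} (β∈Φ , ⟪λ,β∨⟫≡0) = begin
      ⟪ λp , β ⟫                         ≡⟨ ⟪⟫-via-∨ λp β (root-norm≢0 β∈Φ) ⟩
      (⟪ λp , β ∨⟫ * ⟪ β , β ⟫) * ½      ≡⟨ cong (λ q → (q * ⟪ β , β ⟫) * ½) ⟪λ,β∨⟫≡0 ⟩
      (0ℚ * ⟪ β , β ⟫) * ½               ≡⟨ cong (_* ½) (ℚ.*-zeroˡ ⟪ β , β ⟫) ⟩
      0ℚ * ½                             ≡⟨ ℚ.*-zeroˡ ½ ⟩
      0ℚ                                 ∎
      where open ≡-Reasoning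

    module _ {w : V N → V N} (w∈W : InWeyl Φ w) {γ : V N}
             (unique : ∀ β → InInvImgΔ Δ w β → ¬ InΦp Φ λp β → β ≡ γ) where

      ⟪λ,w⁻¹simple⟫≡0⊎c : ∀ i →
        ⟪ λp , inverse w∈W (Δ i) ⟫ ≡ 0ℚ ⊎ ⟪ λp , inverse w∈W (Δ i) ⟫ ≡ ⟪ λp , γ ⟫
      ⟪λ,w⁻¹simple⟫≡0⊎c i with ⟪ λp , inverse w∈W (Δ i) ∨⟫ ℚ.≟ 0ℚ
      ... | yes ∨≡0 = inj₁ (InΦp⇒⟪λ,⟫≡0 (inverse-preserves-Φ w∈W (simple∈ i) , ∨≡0))
      ... | no  ∨≢0 = inj₂ (cong ⟪ λp ,_⟫ (unique _ (i , inverse-inverseʳ w∈W (Δ i)) (∨≢0 ∘ proj₂)))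

      coefficients-against-⟪λ,γ⟫⇒InΦp : ∀ {β} (k : Fin r → ℤ) → Pos Φ Δ β →
        w β ≡ lincomb (ℤtoℚ {N} ∘ k) Δ → (∀ i → ℤtoℚ {N} (k i) * ⟪ λp , γ ⟫ ≤ 0ℚ) → InΦp Φ λp β
      coefficients-against-⟪λ,γ⟫⇒InΦp {β} k β⁺ wβ≡ kc≤0 = Pos∧⟪λ,⟫≤0⇒InΦp β⁺
        (subst (_≤ 0ℚ) (sym (⟪⟫-pullback w∈W λp β (ℤtoℚ {N} ∘ k) Δ wβ≡))
          (∑-*-twoValued-nonPos (ℤtoℚ {N} ∘ k) _ ⟪λ,w⁻¹simple⟫≡0⊎c kc≤0))

      image-Pos : 0ℚ ≤ ⟪ λp , γ ⟫ → ∀ β → Pos Φ Δ β → ¬ InΦp Φ λp β → Pos Φ Δ (w β)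
      image-Pos c≥0 β β⁺ β∉Φp with integral-signs (W-preserves-Φ w∈W (proj₁ β⁺))
      ... | k , wβ≡ , inj₁ k≥0 = W-preserves-Φ w∈W (proj₁ β⁺) , k , wβ≡ , k≥0
      ... | k , wβ≡ , inj₂ k≤0 = ⊥-elim (β∉Φp
        (coefficients-against-⟪λ,γ⟫⇒InΦp k β⁺ wβ≡ (λ i → *-nonPos-nonNeg (k≤0 i) c≥0)))

      image-Neg : ⟪ λp , γ ⟫ ≤ 0ℚ → ∀ β → Pos Φ Δ β → ¬ InΦp Φ λp β → Neg Φ Δ (w β)
      image-Neg c≤0 β β⁺ β∉Φp with integral-signs (W-preserves-Φ w∈W (proj₁ β⁺))
      ... | k , wβ≡ , inj₂ k≤0 = nonPos-coefficients⇒Neg k (W-preserves-Φ w∈W (proj₁ β⁺)) wβ≡ k≤0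
      ... | k , wβ≡ , inj₁ k≥0 = ⊥-elim (β∉Φp
        (coefficients-against-⟪λ,γ⟫⇒InΦp k β⁺ wβ≡ (λ i → *-nonNeg-nonPos (k≥0 i) c≤0)))

lemma10p1 : {N r : ℕ} (Φ : List (V N)) (Δ : Fin r → V N) (p : Fin r) (λp : V N) →
    IsRootSystem Φ → IsReduced Φ → IsIrreducible Φ → IsFundamentalSystem Φ Δ →
    IsFundWeight Δ p λp →
    (w : V N → V N) → InWp Φ Δ p w →
    (∃ λ β → (InInvImgΔ Δ w β × ¬ InΦp Φ λp β) ×
      (∀ γ → InInvImgΔ Δ w γ → ¬ InΦp Φ λp γ → γ ≡ β)) →
    (∀ β → Pos Φ Δ β → ¬ InΦp Φ λp β → Pos Φ Δ (w β))
    ⊎ (∀ β → Pos Φ Δ β → ¬ InΦp Φ λp β → Neg Φ Δ (w β))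
lemma10p1 Φ Δ p λp RS _ _ FS FW w (w∈W , _) (γ , _ , unique) with ℚ.≤-total 0ℚ ⟪ λp , γ ⟫
... | inj₁ ⟪λ,γ⟫≥0 = inj₁ (image-Pos RS FS p λp FW w∈W unique ⟪λ,γ⟫≥0)
... | inj₂ ⟪λ,γ⟫≤0 = inj₂ (image-Neg RS FS p λp FW w∈W unique ⟪λ,γ⟫≤0)
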